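{- For every graph $G$ and all positive integers $h,d$, $\operatorname{rtd}_2(T_{h,d}(G))=\operatorname{rtd}_2(G)+1$.
   Context: Rooted $2$-treedepth: $\operatorname{rtd}_2(G)=0$ if $G$ is null; $=1$ if $G$ has one vertex; otherwise the minimum of $\max\{\operatorname{rtd}_2(A),\operatorname{rtd}_2(B-V(A))+|V(A)\cap V(B)|\}$ over pairs $(A,B)$ of subgraphs with $A\cup B=G$, $E(A\cap B)=\emptyset$, $|V(A)\cap V(B)|\le 1$, $V(A)\ne\emptyset$, $V(B)\setminus V(A)\ne\emptyset$. $G_1\oplus G_2$ is the disjoint union of $G_1,G_2$ plus all edges between them. For positive $d$, graphs $B,H$ and $u\in V(H)$, $L_d(B,H,u)$ is obtained from a copy of $B$ and $d|V(B)|$ copies $H_{i,x}$ ($i\in[d]$, $x\in V(B)$) of $H$ by identifying each $x\in V(B)$ with the copy of $u$ in each $H_{i,x}$. The rooted graph $T_{h,d}(G)$: $T_{1,d}(G)=K_1\oplus G$ rooted at the vertex of $K_1$; for $h>1$, $T_{h,d}(G)=L_d(K_1\oplus G,T_{h-1,d}(G),s)$ where $s$ is the root of $T_{h-1,d}(G)$, rooted at the vertex of $K_1$ in the copy of $K_1\oplus G$ (the first argument). -}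

module Defs where

open import Data.Bool using (Bool; true; false; T; not; _∧_)
open import Data.Bool.Properties using (∧-comm; ∧-zeroʳ; T-∧)
open import Data.Nat using (ℕ; zero; suc; _+_; _≤_)
open import Data.Fin using (Fin)
import Data.Fin.Properties as FinP
open import Data.Unit using (⊤; tt)
import Data.Unit.Properties as UnitP
open import Data.Empty using (⊥)
open import Data.Sum using (_⊎_; inj₁; inj₂)
import Data.Sum.Properties as SumP
open import Data.Product using (Σ; _×_; _,_; ∃; proj₁; proj₂)
import Data.Product.Properties as ProdP
open import Function.Bundles using (_↔_; Equivalence)
open import Relation.Nullary using (¬_; Dec; yes; no)
open import Relation.Nullary.Decidable using (⌊_⌋)
open import Relation.Binary.PropositionalEquality using (_≡_; refl; sym; cong; cong₂)
open import Relation.Binary.Definitions using (DecidableEquality)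

record Graph : Set₁ where
  field
    V     : Set
    _≟_   : DecidableEquality V
    E     : V → V → Bool
    E-sym : ∀ x y → E x y ≡ E y x
    E-irr : ∀ x → E x x ≡ false

open Graph

IsFinite : Graph → Set
IsFinite G = Σ ℕ (λ n → V G ↔ Fin n)

module _ (G : Graph) where

  record Sub : Set where
    field
      vs     : V G → Bool
      es     : V G → V G → Bool
      es⊆E   : ∀ x y → T (es x y) → T (E G x y)
      es-sym : ∀ x y → es x y ≡ es y x
      es-end : ∀ x y → T (es x y) → T (vs x)

  open Sub

  _⊆_ : Sub → Sub → Set
  A ⊆ S = (∀ x → T (vs A x) → T (vs S x)) × (∀ x y → T (es A x y) → T (es S x y))

  _minus_ : Sub → Sub → Sub
  vs (B minus A) x = vs B x ∧ not (vs A x)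
  es (B minus A) x y = es B x y ∧ (not (vs A x) ∧ not (vs A y))
  es⊆E (B minus A) x y p = es⊆E B x y (proj₁ (Equivalence.to T-∧ p))
  es-sym (B minus A) x y
    rewrite es-sym B x y | ∧-comm (not (vs A x)) (not (vs A y)) = refl
  es-end (B minus A) x y p =
    let q = Equivalence.to T-∧ p
        r = Equivalence.to T-∧ (proj₂ q)
    in Equivalence.from T-∧ (es-end B x y (proj₁ q) , proj₁ r)

  full : Sub
  vs full _ = true
  es full = E G
  es⊆E full _ _ p = p
  es-sym full = E-sym G
  es-end full _ _ _ = tt

  data InterSize (A B : Sub) : ℕ → Set where
    none : (∀ x → T (vs A x) → T (vs B x) → ⊥) → InterSize A B 0
    one  : (z : V G) → T (vs A z) → T (vs B z) →
           (∀ x → T (vs A x) → T (vs B x) → x ≡ z) → InterSize A B 1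

  -- Rtd≤ S k  ⇔  rtd₂(S) ≤ k   (inductive rendering of the recursive
  -- min-definition; max{a, b + c} ≤ k  ⇔  a ≤ k ∧ b + c ≤ k)
  data Rtd≤ : Sub → ℕ → Set where
    null   : ∀ {S k} → (∀ x → ¬ T (vs S x)) → Rtd≤ S k
    single : ∀ {S k} (z : V G) → T (vs S z) → (∀ x → T (vs S x) → x ≡ z) →
             1 ≤ k → Rtd≤ S k
    split  : ∀ {S k} (A B : Sub) (c j : ℕ) →
             A ⊆ S → B ⊆ S →
             (∀ x → T (vs S x) → T (vs A x) ⊎ T (vs B x)) →
             (∀ x y → T (es S x y) → T (es A x y) ⊎ T (es B x y)) →
             (∀ x y → T (es A x y) → T (es B x y) → ⊥) →
             InterSize A B c →
             (∃ λ x → T (vs A x)) →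
             (∃ λ x → T (vs B x) × ¬ T (vs A x)) →
             Rtd≤ A k → Rtd≤ (B minus A) j → j + c ≤ k →
             Rtd≤ S k

Rtd : Graph → ℕ → Set
Rtd G k = Rtd≤ G (full G) k × (∀ j → Rtd≤ G (full G) j → k ≤ j)

≟-sym : ∀ {A : Set} (dec : DecidableEquality A) (x y : A) → ⌊ dec x y ⌋ ≡ ⌊ dec y x ⌋
≟-sym dec x y with dec x y | dec y x
... | yes _ | yes _ = refl
... | no _  | no _  = refl
... | yes p | no q  with q (sym p)
... | ()
≟-sym dec x y | no q | yes p with q (sym p)
... | ()

≟-refl : ∀ {A : Set} (dec : DecidableEquality A) (x : A) → ⌊ dec x x ⌋ ≡ true
≟-refl dec x with dec x x
... | yes _ = refl
... | no q with q refl
... | ()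

K₁ : Graph
V K₁ = ⊤
_≟_ K₁ = UnitP._≟_
E K₁ _ _ = false
E-sym K₁ _ _ = refl
E-irr K₁ _ = refl

_⊕_ : Graph → Graph → Graph
V (G₁ ⊕ G₂) = V G₁ ⊎ V G₂
_≟_ (G₁ ⊕ G₂) = SumP.≡-dec (_≟_ G₁) (_≟_ G₂)
E (G₁ ⊕ G₂) (inj₁ x) (inj₁ y) = E G₁ x y
E (G₁ ⊕ G₂) (inj₁ x) (inj₂ y) = true
E (G₁ ⊕ G₂) (inj₂ x) (inj₁ y) = true
E (G₁ ⊕ G₂) (inj₂ x) (inj₂ y) = E G₂ x y
E-sym (G₁ ⊕ G₂) (inj₁ x) (inj₁ y) = E-sym G₁ x y
E-sym (G₁ ⊕ G₂) (inj₁ x) (inj₂ y) = refl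
E-sym (G₁ ⊕ G₂) (inj₂ x) (inj₁ y) = refl
E-sym (G₁ ⊕ G₂) (inj₂ x) (inj₂ y) = E-sym G₂ x y
E-irr (G₁ ⊕ G₂) (inj₁ x) = E-irr G₁ x
E-irr (G₁ ⊕ G₂) (inj₂ x) = E-irr G₂ x

T-dec : ∀ {b} → DecidableEquality (T b)
T-dec {true} tt tt = yes refl

NonU : (H : Graph) → V H → Set
NonU H u = Σ (V H) (λ y → T (not ⌊ _≟_ H y u ⌋))

-- L_d(B, H, u): a copy of B and d·|V(B)| copies H_{i,x} of H, the copy of
-- u in H_{i,x} identified with x.  Vertex set: V(B) ⊎ (Fin d × V(B) × (V(H) - u)),
-- where inj₁ x is x ∈ V(B) (= the copy of u in every H_{i,x}) and
-- inj₂ (i , x , y) is the copy of y ≠ u in H_{i,x}.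
L : (d : ℕ) (B H : Graph) (u : V H) → Graph
V (L d B H u) = V B ⊎ (Fin d × V B × NonU H u)
_≟_ (L d B H u) =
  SumP.≡-dec (_≟_ B)
    (ProdP.≡-dec FinP._≟_ (ProdP.≡-dec (_≟_ B) (ProdP.≡-dec (_≟_ H) T-dec)))
E (L d B H u) (inj₁ x) (inj₁ x′) = E B x x′
E (L d B H u) (inj₁ x) (inj₂ (i , x′ , (y , _))) = ⌊ _≟_ B x x′ ⌋ ∧ E H u y
E (L d B H u) (inj₂ (i , x′ , (y , _))) (inj₁ x) = ⌊ _≟_ B x x′ ⌋ ∧ E H u y
E (L d B H u) (inj₂ (i , x , (y , _))) (inj₂ (i′ , x′ , (y′ , _))) =
  ⌊ FinP._≟_ i i′ ⌋ ∧ (⌊ _≟_ B x x′ ⌋ ∧ E H y y′)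
E-sym (L d B H u) (inj₁ x) (inj₁ x′) = E-sym B x x′
E-sym (L d B H u) (inj₁ x) (inj₂ _) = refl
E-sym (L d B H u) (inj₂ _) (inj₁ x) = refl
E-sym (L d B H u) (inj₂ (i , x , (y , _))) (inj₂ (i′ , x′ , (y′ , _))) =
  cong₂ _∧_ (≟-sym FinP._≟_ i i′) (cong₂ _∧_ (≟-sym (_≟_ B) x x′) (E-sym H y y′))
E-irr (L d B H u) (inj₁ x) = E-irr B x
E-irr (L d B H u) (inj₂ (i , x , (y , _)))
  rewrite ≟-refl FinP._≟_ i | ≟-refl (_≟_ B) x = E-irr H y

record RGraph : Set₁ where
  field
    graph : Graph
    root  : V graph

open RGraph

-- T_{h,d}(G), for h ≥ 1 (the value at h = 0 is an unused dummy equal to T_{1,d}(G)).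
Thd : (h d : ℕ) → Graph → RGraph
Thd zero          d G = record { graph = K₁ ⊕ G ; root = inj₁ tt }
Thd (suc zero)    d G = record { graph = K₁ ⊕ G ; root = inj₁ tt }
Thd (suc (suc h)) d G =
  record { graph = L d (K₁ ⊕ G) (graph (Thd (suc h) d G)) (root (Thd (suc h) d G))
         ; root  = inj₁ (inj₁ tt) }

-- Upper bound. Splitting off the apex of K₁ ⊕ G first gives a decomposition of width rtd₂(G) + 1
-- in which the apex stays in the first part of every split, down to a single vertex. Such rooted
-- decompositions glue: if P meets X only in the root a of P, a rooted decomposition of P is grafted
-- onto one of X by adding X to every first part along the way from P down to a, and the width does
-- not grow. Gluing the d·|V(K₁ ⊕ G)| copies of T_{h-1,d}(G) onto K₁ ⊕ G this way shows, by induction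
-- on h, that T_{h,d}(G) has a rooted decomposition of width rtd₂(G) + 1.
--
-- Lower bound. rtd₂ does not grow when passing to a subgraph, and deleting a vertex adjacent to all
-- others lowers it by at least one: in a split S = A ∪ B that vertex either lies in both parts, which
-- then share nothing else, or A is a single vertex and the deleted vertex dominates B − A. Since
-- K₁ ⊕ G is a subgraph of T_{h,d}(G) whose apex dominates it, rtd₂(T_{h,d}(G)) ≥ rtd₂(G) + 1.

module Submission where

open import Data.Bool using (Bool; true; false; T; not; _∧_; _∨_)
open import Data.Bool.Properties using (T-∧; T-∨; T-irrelevant; ∨-assoc; ∨-comm)
open import Data.Empty using (⊥; ⊥-elim)
open import Data.Fin using (Fin)
import Data.Fin.Properties as FinP
open import Data.List using (List; []; _∷_; map; allFin; cartesianProduct)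
open import Data.List.Membership.Propositional using (_∈_; lose)
open import Data.List.Membership.Propositional.Properties using (∈-map⁺; ∈-allFin; ∈-cartesianProduct⁺)
open import Data.List.Relation.Unary.Any using (here; there; any?; satisfied)
open import Data.Maybe using (Maybe; just; nothing)
open import Data.Nat using (ℕ; zero; suc; pred; _+_; _≤_; z≤n; s≤s; >-nonZero)
open import Data.Nat.Properties
  using (≤-reflexive; ≤-trans; m≤m+n; m≤n+m; +-comm; +-monoʳ-≤; +-suc; pred-mono-≤; m≤pred[n]⇒suc[m]≤n)
open import Data.Product using (Σ; _×_; _,_; ∃; proj₁; proj₂)
open import Data.Product.Properties using () renaming (≡-dec to ×-≡-dec)
open import Data.Sum using (_⊎_; inj₁; inj₂; [_,_]′)
open import Data.Sum.Properties using (inj₁-injective; inj₂-injective)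
open import Data.Unit using (⊤; tt)
open import Function using (id)
open import Function.Bundles using (Equivalence; Inverse)
open import Relation.Binary.Definitions using (DecidableEquality)
open import Relation.Binary.PropositionalEquality
  using (_≡_; _≢_; refl; sym; trans; cong; subst; subst₂)
open import Relation.Nullary using (¬_; Dec; yes; no)
open import Relation.Nullary.Decidable
  using (T?; ⌊_⌋; decidable-stable; toWitness; fromWitness; toWitnessFalse; fromWitnessFalse)

open import Defs

open Graph
open Sub

private variable
  c j k : ℕ

-- Stated for Booleans: a subgraph is not determined by the Boolean it contributes to a membership
-- type, so the implicit arguments of subgraph-level versions could not be inferred.
module _ {a b : Bool} where

  ∧-intro : T a → T b → T (a ∧ b)
  ∧-intro p q = Equivalence.from T-∧ (p , q)

  ∧-elimˡ : T (a ∧ b) → T a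
  ∧-elimˡ p = proj₁ (Equivalence.to T-∧ p)

  ∧-elimʳ : T (a ∧ b) → T b
  ∧-elimʳ p = proj₂ (Equivalence.to T-∧ p)

  ∨-introˡ : T a → T (a ∨ b)
  ∨-introˡ p = Equivalence.from T-∨ (inj₁ p)

  ∨-introʳ : T b → T (a ∨ b)
  ∨-introʳ p = Equivalence.from T-∨ (inj₂ p)

  ∨-elim : T (a ∨ b) → T a ⊎ T b
  ∨-elim = Equivalence.to T-∨

not-intro : ∀ {b} → ¬ T b → T (not b)
not-intro {true}  ¬b = ¬b tt
not-intro {false} _  = tt

not-elim : ∀ {b} → T (not b) → ¬ T b
not-elim {true} ()

-- Decidable existence: the only use made of finiteness besides listing the copies in L_d(B, H, r).
Searchable : Set → Set
Searchable A = ∀ (b : A → Bool) → Dec (∃ λ x → T (b x))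

module _ {Γ : Graph} where

  infix 4 _∈ᵥ_ _∉ᵥ_

  _∈ᵥ_ : V Γ → Sub Γ → Set
  x ∈ᵥ S = T (vs S x)

  _∉ᵥ_ : V Γ → Sub Γ → Set
  x ∉ᵥ S = ¬ x ∈ᵥ S

  Edge : Sub Γ → V Γ → V Γ → Set
  Edge S x y = T (es S x y)

  Edge-endʳ : ∀ (S : Sub Γ) x y → Edge S x y → y ∈ᵥ S
  Edge-endʳ S x y e = es-end S y x (subst T (es-sym S x y) e)

  Edge-loop : ∀ (S : Sub Γ) {x y} → x ≡ y → ¬ Edge S x y
  Edge-loop S {x} refl e = subst T (E-irr Γ x) (es⊆E S x x e)

infix 4 _⊑⟨_⟩_

record _⊑⟨_⟩_ {Δ Γ : Graph} (S′ : Sub Δ) (f : V Δ → V Γ) (S : Sub Γ) : Set where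
  constructor mk⊑
  field
    ⊑-vs : ∀ x → x ∈ᵥ S′ → f x ∈ᵥ S
    ⊑-es : ∀ x y → Edge S′ x y → Edge S (f x) (f y)

open _⊑⟨_⟩_ public

module _ {Γ : Graph} where

  infix 4 _⊑_ _≐_

  private variable
    A B P S S′ X : Sub Γ

  _⊑_ : Sub Γ → Sub Γ → Set
  A ⊑ S = A ⊑⟨ id ⟩ S

  _≐_ : Sub Γ → Sub Γ → Set
  A ≐ B = A ⊑ B × B ⊑ A

  ⊑⇒⊆ : A ⊑ S → _⊆_ Γ A S
  ⊑⇒⊆ A⊑S = ⊑-vs A⊑S , ⊑-es A⊑S

  ⊆⇒⊑ : _⊆_ Γ A S → A ⊑ S
  ⊆⇒⊑ (v , e) = mk⊑ v e

  ⊑-refl : A ⊑ A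
  ⊑-refl = mk⊑ (λ _ p → p) (λ _ _ e → e)

  ⊑-trans : A ⊑ B → B ⊑ S → A ⊑ S
  ⊑-trans A⊑B B⊑S =
    mk⊑ (λ x p → ⊑-vs B⊑S x (⊑-vs A⊑B x p)) (λ x y e → ⊑-es B⊑S x y (⊑-es A⊑B x y e))

  ⊑-full : S ⊑ full Γ
  ⊑-full {S = S} = mk⊑ (λ _ _ → tt) (es⊆E S)

  infixl 6 _∖_
  infixl 5 _∪_

  _∖_ : Sub Γ → Sub Γ → Sub Γ
  _∖_ = _minus_ _

  ∖-⊑ : B ∖ A ⊑ B
  ∖-⊑ = mk⊑ (λ _ → ∧-elimˡ) (λ _ _ → ∧-elimˡ)

  ∖-mono : ∀ {A′ B′} → B ⊑ B′ → (∀ x → x ∈ᵥ B → x ∈ᵥ A′ → x ∈ᵥ A) → B ∖ A ⊑ B′ ∖ A′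
  ∖-mono {B = B} {A = A} {A′} {B′} B⊑B′ shrink = mk⊑ vs⊑ es⊑
    where
      ∉A′ : ∀ {x} → x ∈ᵥ B → T (not (vs A x)) → T (not (vs A′ x))
      ∉A′ {x} xB x∉A = not-intro (λ xA′ → not-elim x∉A (shrink x xB xA′))
      vs⊑ : ∀ x → x ∈ᵥ B ∖ A → x ∈ᵥ B′ ∖ A′
      vs⊑ x p = ∧-intro (⊑-vs B⊑B′ x (∧-elimˡ p)) (∉A′ (∧-elimˡ p) (∧-elimʳ p))
      es⊑ : ∀ x y → Edge (B ∖ A) x y → Edge (B′ ∖ A′) x y
      es⊑ x y e = ∧-intro (⊑-es B⊑B′ x y e′)
                          (∧-intro (∉A′ (es-end B x y e′) (∧-elimˡ ends))
                                   (∉A′ (Edge-endʳ B x y e′) (∧-elimʳ ends)))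
        where
          e′ : Edge B x y
          e′ = ∧-elimˡ e
          ends : T (not (vs A x) ∧ not (vs A y))
          ends = ∧-elimʳ {a = es B x y} e

  ∖-∖-⊑ : (B ∖ X) ∖ (A ∖ X) ⊑ (B ∖ A) ∖ X
  ∖-∖-⊑ {B = B} {X = X} {A = A} =
    mk⊑ (λ x → vs-taut (vs B x) (vs X x) (vs A x))
        (λ x y → es-taut (es B x y) (vs X x) (vs X y) (vs A x) (vs A y))
    where
      vs-taut : ∀ b x a → T ((b ∧ not x) ∧ not (a ∧ not x)) → T ((b ∧ not a) ∧ not x)
      vs-taut false _     _     ()
      vs-taut true  true  _     ()
      vs-taut true  false true  ()
      vs-taut true  false false _ = tt
      es-taut : ∀ e x y a b → T ((e ∧ (not x ∧ not y)) ∧ (not (a ∧ not x) ∧ not (b ∧ not y))) →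
                T ((e ∧ (not a ∧ not b)) ∧ (not x ∧ not y))
      es-taut false _     _     _     _     ()
      es-taut true  true  _     _     _     ()
      es-taut true  false true  _     _     ()
      es-taut true  false false true  _     ()
      es-taut true  false false false true  ()
      es-taut true  false false false false _ = tt

  _∪_ : Sub Γ → Sub Γ → Sub Γ
  vs (A ∪ B) x = vs A x ∨ vs B x
  es (A ∪ B) x y = es A x y ∨ es B x y
  es⊆E (A ∪ B) x y e = [ es⊆E A x y , es⊆E B x y ]′ (∨-elim e)
  es-sym (A ∪ B) x y rewrite es-sym A x y | es-sym B x y = refl
  es-end (A ∪ B) x y e =
    [ (λ e′ → ∨-introˡ (es-end A x y e′)) , (λ e′ → ∨-introʳ (es-end B x y e′)) ]′ (∨-elim e)

  ∪-⊑ˡ : A ⊑ A ∪ B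
  ∪-⊑ˡ = mk⊑ (λ _ → ∨-introˡ) (λ _ _ → ∨-introˡ)

  ∪-lub : A ⊑ S → B ⊑ S → A ∪ B ⊑ S
  ∪-lub A⊑S B⊑S = mk⊑ (λ x p → [ ⊑-vs A⊑S x , ⊑-vs B⊑S x ]′ (∨-elim p))
                       (λ x y e → [ ⊑-es A⊑S x y , ⊑-es B⊑S x y ]′ (∨-elim e))

  ∪-assoc-swap : (X ∪ A) ∪ B ≐ X ∪ (B ∪ A)
  ∪-assoc-swap {X = X} {A = A} {B = B} =
      mk⊑ (λ x → subst T (swap (vs X x) (vs A x) (vs B x)))
          (λ x y → subst T (swap (es X x y) (es A x y) (es B x y)))
    , mk⊑ (λ x → subst T (sym (swap (vs X x) (vs A x) (vs B x))))
          (λ x y → subst T (sym (swap (es X x y) (es A x y) (es B x y))))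
    where
      swap : ∀ a b c → (a ∨ b) ∨ c ≡ a ∨ (c ∨ b)
      swap a b c = trans (∨-assoc a b c) (cong (a ∨_) (∨-comm b c))

  ∖-∪-≐ : (∀ x → x ∈ᵥ X → x ∈ᵥ B → x ∈ᵥ A) → B ∖ A ≐ B ∖ (X ∪ A)
  ∖-∪-≐ {X = X} {B = B} {A = A} X∩B⊆A =
      ∖-mono {A′ = X ∪ A} {B′ = B} ⊑-refl (λ x xB p → [ (λ xX → X∩B⊆A x xX xB) , id ]′ (∨-elim p))
    , ∖-mono {A′ = A} {B′ = B} ⊑-refl (λ _ _ xA → ∨-introʳ xA)

  ∅ : Sub Γ
  vs ∅ _ = false
  es ∅ _ _ = false
  es⊆E ∅ _ _ ()
  es-sym ∅ _ _ = refl
  es-end ∅ _ _ ()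

  ∪-∅ : X ≐ X ∪ ∅
  ∪-∅ {X = X} = mk⊑ (λ _ → ∨-introˡ) (λ _ _ → ∨-introˡ)
              , mk⊑ (λ x p → [ id , (λ ()) ]′ (∨-elim {a = vs X x} p))
                    (λ x y e → [ id , (λ ()) ]′ (∨-elim {a = es X x y} e))

  ∪-absorb : A ⊑ B → X ∪ B ≐ X ∪ (A ∪ B)
  ∪-absorb {A = A} {B = B} {X = X} A⊑B =
      mk⊑ (λ x p → [ ∨-introˡ , (λ q → ∨-introʳ {a = vs X x} (∨-introʳ {a = vs A x} q)) ]′
                     (∨-elim {a = vs X x} p))
          (λ x y e → [ ∨-introˡ , (λ q → ∨-introʳ {a = es X x y} (∨-introʳ {a = es A x y} q)) ]′
                       (∨-elim {a = es X x y} e))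
    , mk⊑ (λ x p → [ ∨-introˡ , (λ q → ∨-introʳ ([ ⊑-vs A⊑B x , id ]′ (∨-elim q))) ]′
                     (∨-elim {a = vs X x} p))
          (λ x y e → [ ∨-introˡ , (λ q → ∨-introʳ ([ ⊑-es A⊑B x y , id ]′ (∨-elim q))) ]′
                       (∨-elim {a = es X x y} e))

  ⋃ : {I : Set} → (I → Sub Γ) → List I → Sub Γ
  ⋃ P []       = ∅
  ⋃ P (i ∷ is) = P i ∪ ⋃ P is

  module _ {I : Set} {P : I → Sub Γ} where

    ⊑-⋃ : ∀ {i is} → i ∈ is → P i ⊑ ⋃ P is
    ⊑-⋃ (here refl) = mk⊑ (λ _ → ∨-introˡ) (λ _ _ → ∨-introˡ)
    ⊑-⋃ (there i∈is) =
      mk⊑ (λ x p → ∨-introʳ (⊑-vs (⊑-⋃ i∈is) x p)) (λ x y e → ∨-introʳ (⊑-es (⊑-⋃ i∈is) x y e))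

    ⋃-∈⁻ : ∀ {x} is → x ∈ᵥ ⋃ P is → ∃ λ i → i ∈ is × x ∈ᵥ P i
    ⋃-∈⁻ []       ()
    ⋃-∈⁻ (i ∷ is) p with ∨-elim p
    ... | inj₁ xP = i , here refl , xP
    ... | inj₂ x⋃ with ⋃-∈⁻ is x⋃
    ...   | i′ , i′∈is , xP = i′ , there i′∈is , xP

  NonEmpty : Sub Γ → Set
  NonEmpty S = ∃ λ x → x ∈ᵥ S

  _⊈ᵥ_ : Sub Γ → Sub Γ → Set
  B ⊈ᵥ A = ∃ λ x → x ∈ᵥ B × x ∉ᵥ A

  record Cover (S A B : Sub Γ) : Set where
    constructor cover
    field
      A⊑S           : A ⊑ S
      B⊑S           : B ⊑ S
      vertices      : ∀ x → x ∈ᵥ S → x ∈ᵥ A ⊎ x ∈ᵥ B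
      edges         : ∀ x y → Edge S x y → Edge A x y ⊎ Edge B x y
      edge-disjoint : ∀ x y → Edge A x y → Edge B x y → ⊥

  Cover-resp-≐ : S ≐ S′ → Cover S A B → Cover S′ A B
  Cover-resp-≐ (S⊑S′ , S′⊑S) (cover A⊑S B⊑S cv ce ed) =
    cover (⊑-trans A⊑S S⊑S′) (⊑-trans B⊑S S⊑S′)
          (λ x p → cv x (⊑-vs S′⊑S x p)) (λ x y e → ce x y (⊑-es S′⊑S x y e)) ed

  split′ : Cover S A B → InterSize Γ A B c → NonEmpty A → B ⊈ᵥ A →
           Rtd≤ Γ A k → Rtd≤ Γ (B ∖ A) j → j + c ≤ k → Rtd≤ Γ S k
  split′ (cover A⊑S B⊑S cv ce ed) = split _ _ _ _ (⊑⇒⊆ A⊑S) (⊑⇒⊆ B⊑S) cv ce ed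

  Rtd≤-resp-≐ : S ≐ S′ → Rtd≤ Γ S k → Rtd≤ Γ S′ k
  Rtd≤-resp-≐ (_ , S′⊑S) (null S-empty) = null (λ x p → S-empty x (⊑-vs S′⊑S x p))
  Rtd≤-resp-≐ (S⊑S′ , S′⊑S) (single z z∈S uniq 1≤k) =
    single z (⊑-vs S⊑S′ z z∈S) (λ x p → uniq x (⊑-vs S′⊑S x p)) 1≤k
  Rtd≤-resp-≐ S≐S′ (split _ _ _ _ A⊆S B⊆S cv ce ed isz neA fr dA dB le) =
    split′ (Cover-resp-≐ S≐S′ (cover (⊆⇒⊑ A⊆S) (⊆⇒⊑ B⊆S) cv ce ed)) isz neA fr dA dB le

  Rtd≤-mono : j ≤ k → Rtd≤ Γ S j → Rtd≤ Γ S k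
  Rtd≤-mono _ (null S-empty) = null S-empty
  Rtd≤-mono j≤k (single z z∈S uniq 1≤j) = single z z∈S uniq (≤-trans 1≤j j≤k)
  Rtd≤-mono j≤k (split A B c i A⊑S B⊑S cv ce ed isz neA fr dA dB le) =
    split A B c i A⊑S B⊑S cv ce ed isz neA fr (Rtd≤-mono j≤k dA) dB (≤-trans le j≤k)

  Rtd≤-nonempty⇒1≤ : Rtd≤ Γ S k → NonEmpty S → 1 ≤ k
  Rtd≤-nonempty⇒1≤ (null S-empty) (x , p) = ⊥-elim (S-empty x p)
  Rtd≤-nonempty⇒1≤ (single _ _ _ 1≤k) _ = 1≤k
  Rtd≤-nonempty⇒1≤ (split _ _ _ _ _ _ _ _ _ _ neA _ dA _ _) _ = Rtd≤-nonempty⇒1≤ dA neA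

  data Overlap≤ (A B : Sub Γ) : ℕ → Set where
    disjoint    : (∀ x → x ∈ᵥ A → x ∈ᵥ B → ⊥) → Overlap≤ A B 0
    at-most-one : (∀ x y → x ∈ᵥ A → x ∈ᵥ B → y ∈ᵥ A → y ∈ᵥ B → x ≡ y) → Overlap≤ A B (suc c)

  Overlap≤-unique : ∀ {x y} → Overlap≤ A B c → x ∈ᵥ A → x ∈ᵥ B → y ∈ᵥ A → y ∈ᵥ B → x ≡ y
  Overlap≤-unique (disjoint d)    xA xB _ _ = ⊥-elim (d _ xA xB)
  Overlap≤-unique (at-most-one u) = u _ _

  Overlap≤-meet⇒1≤ : ∀ {x} → Overlap≤ A B c → x ∈ᵥ A → x ∈ᵥ B → 1 ≤ c
  Overlap≤-meet⇒1≤ (disjoint d)    xA xB = ⊥-elim (d _ xA xB)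
  Overlap≤-meet⇒1≤ (at-most-one _) _  _  = s≤s z≤n

  InterSize⇒Overlap≤ : InterSize Γ A B c → Overlap≤ A B c
  InterSize⇒Overlap≤ (none d) = disjoint d
  InterSize⇒Overlap≤ (one z _ _ uniq) =
    at-most-one (λ x y xA xB yA yB → trans (uniq x xA xB) (sym (uniq y yA yB)))

  Overlap≤⇒InterSize : Searchable (V Γ) → Overlap≤ A B c → ∃ λ c′ → InterSize Γ A B c′ × c′ ≤ c
  Overlap≤⇒InterSize {A = A} {B = B} search o with search (λ x → vs A x ∧ vs B x)
  ... | no A∩B-empty = 0 , none (λ x xA xB → A∩B-empty (x , ∧-intro xA xB)) , z≤n
  ... | yes (z , z∈A∩B) =
    1 , one z zA zB (λ x xA xB → Overlap≤-unique o xA xB zA zB) , Overlap≤-meet⇒1≤ o zA zB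
    where
      zA : z ∈ᵥ A
      zA = ∧-elimˡ z∈A∩B
      zB : z ∈ᵥ B
      zB = ∧-elimʳ z∈A∩B

  Cover-emptyˡ : Cover S A B → (∀ x → x ∉ᵥ A) → B ∖ A ≐ S
  Cover-emptyˡ {S = S} {A = A} {B = B} cv A-empty = ⊑-trans ∖-⊑ B⊑S , mk⊑ vs⊑ es⊑
    where
      open Cover cv
      vs⊑ : ∀ x → x ∈ᵥ S → x ∈ᵥ B ∖ A
      vs⊑ x p =
        [ (λ q → ⊥-elim (A-empty x q)) , (λ q → ∧-intro q (not-intro (A-empty x))) ]′ (vertices x p)
      es⊑ : ∀ x y → Edge S x y → Edge (B ∖ A) x y
      es⊑ x y e =
        [ (λ e′ → ⊥-elim (A-empty x (es-end A x y e′)))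
        , (λ e′ → ∧-intro e′ (∧-intro (not-intro (A-empty x)) (not-intro (A-empty y)))) ]′ (edges x y e)

  Cover-⊆ˡ : Cover S A B → Overlap≤ A B c → (∀ x → x ∈ᵥ B → x ∈ᵥ A) → A ≐ S
  Cover-⊆ˡ {S = S} {A = A} {B = B} cv o B⊆A = A⊑S , mk⊑ (λ x p → [ id , B⊆A x ]′ (vertices x p)) es⊑
    where
      open Cover cv
      es⊑ : ∀ x y → Edge S x y → Edge A x y
      es⊑ x y e = [ id , (λ e′ → ⊥-elim (Edge-loop S (loop e′) e)) ]′ (edges x y e)
        where
          loop : Edge B x y → x ≡ y
          loop e′ = Overlap≤-unique o (B⊆A x (es-end B x y e′)) (es-end B x y e′)
                                      (B⊆A y (Edge-endʳ B x y e′)) (Edge-endʳ B x y e′)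

  -- The splits excluded by the definition (V(A) = ∅ or V(B) ⊆ V(A)) collapse to one of the parts,
  -- so any cover of bounded overlap may be used.
  Rtd≤-split : Searchable (V Γ) → Cover S A B → Overlap≤ A B c →
               Rtd≤ Γ A k → Rtd≤ Γ (B ∖ A) j → j + c ≤ k → Rtd≤ Γ S k
  Rtd≤-split {A = A} {B = B} search cv o dA dB j+c≤k with search (vs A)
  ... | no A-empty =
    Rtd≤-mono (≤-trans (m≤m+n _ _) j+c≤k) (Rtd≤-resp-≐ (Cover-emptyˡ cv (λ x p → A-empty (x , p))) dB)
  ... | yes neA with search (λ x → vs B x ∧ not (vs A x))
  ...   | no B∖A-empty = Rtd≤-resp-≐ (Cover-⊆ˡ cv o B⊆A) dA
    where
      B⊆A : ∀ x → x ∈ᵥ B → x ∈ᵥ A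
      B⊆A x p with T? (vs A x)
      ... | yes q = q
      ... | no q = ⊥-elim (B∖A-empty (x , ∧-intro p (not-intro q)))
  ...   | yes (b , b∈B∖A) with Overlap≤⇒InterSize search o
  ...     | c′ , isz , c′≤c =
    split′ cv isz neA (b , ∧-elimˡ b∈B∖A , not-elim (∧-elimʳ b∈B∖A)) dA dB
           (≤-trans (+-monoʳ-≤ _ c′≤c) j+c≤k)

  Cover-∖ : Cover S A B → Cover (S ∖ X) (A ∖ X) (B ∖ X)
  Cover-∖ {S = S} {A = A} {B = B} {X = X} (cover A⊑S B⊑S cv ce ed) =
    cover (∖-mono {A′ = X} {B′ = S} A⊑S (λ _ _ xX → xX))
          (∖-mono {A′ = X} {B′ = S} B⊑S (λ _ _ xX → xX))
          vs-cover es-cover (λ x y e₁ e₂ → ed x y (∧-elimˡ e₁) (∧-elimˡ e₂))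
    where
      vs-cover : ∀ x → x ∈ᵥ S ∖ X → x ∈ᵥ A ∖ X ⊎ x ∈ᵥ B ∖ X
      vs-cover x p =
        [ (λ q → inj₁ (∧-intro q (∧-elimʳ p))) , (λ q → inj₂ (∧-intro q (∧-elimʳ p))) ]′
          (cv x (∧-elimˡ p))
      es-cover : ∀ x y → Edge (S ∖ X) x y → Edge (A ∖ X) x y ⊎ Edge (B ∖ X) x y
      es-cover x y e = [ (λ q → inj₁ (∧-intro q (∧-elimʳ {a = es S x y} e)))
                       , (λ q → inj₂ (∧-intro q (∧-elimʳ {a = es S x y} e))) ]′ (ce x y (∧-elimˡ e))

  Overlap≤-∖ : ∀ {c} → Overlap≤ A B c → Overlap≤ (A ∖ X) (B ∖ X) c
  Overlap≤-∖ (disjoint A∩B-empty) = disjoint (λ x p q → A∩B-empty x (∧-elimˡ p) (∧-elimˡ q))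
  Overlap≤-∖ (at-most-one uniq) =
    at-most-one (λ x y px qx py qy → uniq x y (∧-elimˡ px) (∧-elimˡ qx) (∧-elimˡ py) (∧-elimˡ qy))

  -- Rooted decompositions and gluing

  data Rooted : Sub Γ → V Γ → ℕ → Set where
    single : ∀ {S v k} → v ∈ᵥ S → (∀ x → x ∈ᵥ S → x ≡ v) → 1 ≤ k → Rooted S v k
    split  : ∀ {S A B v c j k} → Cover S A B → InterSize Γ A B c → B ⊈ᵥ A → v ∈ᵥ A →
             Rooted A v k → Rtd≤ Γ (B ∖ A) j → j + c ≤ k → Rooted S v k

  Rooted-root∈ : ∀ {v} → Rooted S v k → v ∈ᵥ S
  Rooted-root∈ (single v∈S _ _) = v∈S
  Rooted-root∈ (split cv _ _ v∈A _ _ _) = ⊑-vs (Cover.A⊑S cv) _ v∈A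

  Rooted⇒Rtd≤ : ∀ {v} → Rooted S v k → Rtd≤ Γ S k
  Rooted⇒Rtd≤ (single v∈S uniq 1≤k) = single _ v∈S uniq 1≤k
  Rooted⇒Rtd≤ (split cv isz fr v∈A dA dB le) = split′ cv isz (_ , v∈A) fr (Rooted⇒Rtd≤ dA) dB le

  Rooted-resp-≐ : ∀ {v} → S ≐ S′ → Rooted S v k → Rooted S′ v k
  Rooted-resp-≐ (S⊑S′ , S′⊑S) (single v∈S uniq 1≤k) =
    single (⊑-vs S⊑S′ _ v∈S) (λ x p → uniq x (⊑-vs S′⊑S x p)) 1≤k
  Rooted-resp-≐ S≐S′ (split cv isz fr v∈A dA dB le) =
    split (Cover-resp-≐ S≐S′ cv) isz fr v∈A dA dB le

  Cover-glue : ∀ {a} → Cover P A B → (∀ y → y ∈ᵥ P → y ∈ᵥ X → y ≡ a) → Cover (X ∪ P) (X ∪ A) B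
  Cover-glue {P = P} {A = A} {B = B} {X = X} (cover A⊑P B⊑P cv ce ed) meet =
    cover (mk⊑ (λ x p → [ ∨-introˡ , (λ q → ∨-introʳ (⊑-vs A⊑P x q)) ]′ (∨-elim p))
               (λ x y e → [ ∨-introˡ , (λ q → ∨-introʳ (⊑-es A⊑P x y q)) ]′ (∨-elim e)))
          (mk⊑ (λ x p → ∨-introʳ (⊑-vs B⊑P x p)) (λ x y e → ∨-introʳ (⊑-es B⊑P x y e)))
          vs-cover es-cover es-disjoint
    where
      vs-cover : ∀ x → x ∈ᵥ X ∪ P → x ∈ᵥ X ∪ A ⊎ x ∈ᵥ B
      vs-cover x p = [ (λ xX → inj₁ (∨-introˡ xX))
                     , (λ xP → [ (λ xA → inj₁ (∨-introʳ xA)) , inj₂ ]′ (cv x xP)) ]′ (∨-elim p)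
      es-cover : ∀ x y → Edge (X ∪ P) x y → Edge (X ∪ A) x y ⊎ Edge B x y
      es-cover x y e = [ (λ eX → inj₁ (∨-introˡ eX))
                       , (λ eP → [ (λ eA → inj₁ (∨-introʳ eA)) , inj₂ ]′ (ce x y eP)) ]′ (∨-elim e)
      es-disjoint : ∀ x y → Edge (X ∪ A) x y → Edge B x y → ⊥
      es-disjoint x y e eB =
        [ (λ eX → Edge-loop X (trans (at-a x (es-end X x y eX) (es-end B x y eB))
                                     (sym (at-a y (Edge-endʳ X x y eX) (Edge-endʳ B x y eB)))) eX)
        , (λ eA → ed x y eA eB) ]′ (∨-elim e)
        where
          at-a : ∀ z → z ∈ᵥ X → z ∈ᵥ B → z ≡ _
          at-a z zX zB = meet z (⊑-vs B⊑P z zB) zX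

  InterSize-∪ˡ : (∀ x → x ∈ᵥ X → x ∈ᵥ B → x ∈ᵥ A) → InterSize Γ A B c → InterSize Γ (X ∪ A) B c
  InterSize-∪ˡ {X = X} {B = B} {A = A} X∩B⊆A (none A∩B-empty) =
    none (λ x p xB → A∩B-empty x ([ (λ xX → X∩B⊆A x xX xB) , id ]′ (∨-elim p)) xB)
  InterSize-∪ˡ X∩B⊆A (one z zA zB uniq) =
    one z (∨-introʳ zA) zB (λ x p xB → uniq x ([ (λ xX → X∩B⊆A x xX xB) , id ]′ (∨-elim p)) xB)

  Rooted-glue : ∀ {v a} → Rooted X v k → a ∈ᵥ X → (∀ y → y ∈ᵥ P → y ∈ᵥ X → y ≡ a) →
                Rooted P a k → Rooted (X ∪ P) v k
  Rooted-glue {X = X} {P = P} dX a∈X meet (single a∈P uniq _) =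
    Rooted-resp-≐ (∪-⊑ˡ , ∪-lub ⊑-refl P⊑X) dX
    where
      P⊑X : P ⊑ X
      P⊑X = mk⊑ (λ x p → subst (_∈ᵥ X) (sym (uniq x p)) a∈X)
                (λ x y e → ⊥-elim (Edge-loop P (trans (uniq x (es-end P x y e))
                                                      (sym (uniq y (Edge-endʳ P x y e)))) e))
  Rooted-glue {X = X} {P = P} {a = a} dX a∈X meet
              (split {A = A} {B = B} cv isz (b , b∈B , b∉A) a∈A dA dB le) =
    split (Cover-glue {X = X} cv meet) (InterSize-∪ˡ {X = X} X∩B⊆A isz) (b , b∈B , b∉X∪A)
          (∨-introˡ (Rooted-root∈ dX))
          (Rooted-glue dX a∈X (λ y yA → meet y (⊑-vs (Cover.A⊑S cv) y yA)) dA)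
          (Rtd≤-resp-≐ (∖-∪-≐ {X = X} {B = B} {A = A} X∩B⊆A) dB) le
    where
      X∩B⊆A : ∀ x → x ∈ᵥ X → x ∈ᵥ B → x ∈ᵥ A
      X∩B⊆A x xX xB = subst (_∈ᵥ A) (sym (meet x (⊑-vs (Cover.B⊑S cv) x xB) xX)) a∈A
      b∉X∪A : b ∉ᵥ X ∪ A
      b∉X∪A p = [ (λ bX → b∉A (X∩B⊆A b bX b∈B)) , b∉A ]′ (∨-elim p)

  module _ {I : Set} (_≟ᵢ_ : DecidableEquality I) {P : I → Sub Γ} {a : I → V Γ} {X v}
           (dX : Rooted X v k) (a∈X : ∀ i → a i ∈ᵥ X) (dP : ∀ i → Rooted (P i) (a i) k)
           (meet : ∀ i y → y ∈ᵥ P i → y ∈ᵥ X → y ≡ a i)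
           (apart : ∀ i i′ y → i ≢ i′ → y ∈ᵥ P i → y ∈ᵥ P i′ → y ∈ᵥ X) where

    open import Data.List.Membership.DecPropositional _≟ᵢ_ using (_∈?_)

    Rooted-glue-all : ∀ is → Rooted (X ∪ ⋃ P is) v k
    Rooted-glue-all [] = Rooted-resp-≐ ∪-∅ dX
    Rooted-glue-all (i ∷ is) with i ∈? is
    ... | yes i∈is = Rooted-resp-≐ (∪-absorb {X = X} (⊑-⋃ i∈is)) (Rooted-glue-all is)
    ... | no i∉is =
      Rooted-resp-≐ (∪-assoc-swap {X = X} {A = ⋃ P is} {B = P i})
                    (Rooted-glue (Rooted-glue-all is) (∨-introˡ (a∈X i)) meet-i (dP i))
      where
        meet-i : ∀ y → y ∈ᵥ P i → y ∈ᵥ X ∪ ⋃ P is → y ≡ a i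
        meet-i y yPi p with ∨-elim p
        ... | inj₁ yX = meet i y yPi yX
        ... | inj₂ y⋃ with ⋃-∈⁻ is y⋃
        ...   | i′ , i′∈is , yPi′ = meet i y yPi (apart i i′ y (λ { refl → i∉is i′∈is }) yPi yPi′)

record Embedding (Δ Γ : Graph) : Set where
  field
    to      : V Δ → V Γ
    from    : V Γ → Maybe (V Δ)
    from-to : ∀ x → from (to x) ≡ just x
    to-from : ∀ {y x} → from y ≡ just x → to x ≡ y
    E-to    : ∀ x x′ → E Γ (to x) (to x′) ≡ E Δ x x′

module _ {Δ Γ : Graph} (φ : Embedding Δ Γ) where
  open Embedding φ

  private
    lift₁ : (V Δ → Bool) → Maybe (V Δ) → Bool
    lift₁ p (just x) = p x
    lift₁ p nothing  = false

    lift₂ : (V Δ → V Δ → Bool) → Maybe (V Δ) → Maybe (V Δ) → Bool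
    lift₂ r (just x) (just x′) = r x x′
    lift₂ r _        _         = false

  image : Sub Δ → Sub Γ
  vs (image S) y = lift₁ (vs S) (from y)
  es (image S) y z = lift₂ (es S) (from y) (from z)
  es⊆E (image S) y z e with from y in eq₁ | from z in eq₂
  ... | just x | just x′ =
    subst₂ (λ u w → T (E Γ u w)) (to-from eq₁) (to-from eq₂)
           (subst T (sym (E-to x x′)) (es⊆E S x x′ e))
  es-sym (image S) y z with from y | from z
  ... | just x  | just x′ = es-sym S x x′
  ... | just _  | nothing = refl
  ... | nothing | just _  = refl
  ... | nothing | nothing = refl
  es-end (image S) y z e with from y | from z
  ... | just x | just x′ = es-end S x x′ e

  from∈image : ∀ S y {x} → from y ≡ just x → x ∈ᵥ S → y ∈ᵥ image S
  from∈image S y eq p rewrite eq = p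

  to∈image : ∀ S {x} → x ∈ᵥ S → to x ∈ᵥ image S
  to∈image S {x} = from∈image S (to x) (from-to x)

  image-from : ∀ S {y} → y ∈ᵥ image S → ∃ λ x → from y ≡ just x
  image-from S {y} p with from y
  ... | just x = x , refl

  image-full-edge : ∀ y z {x x′} → from y ≡ just x → from z ≡ just x′ → T (E Γ y z) →
                    Edge (image (full Δ)) y z
  image-full-edge y z {x} {x′} eq₁ eq₂ e rewrite eq₁ | eq₂ | sym (to-from eq₁) | sym (to-from eq₂) =
    subst T (E-to x x′) e

  to∈image⁻ : ∀ S {x} → to x ∈ᵥ image S → x ∈ᵥ S
  to∈image⁻ S {x} p rewrite from-to x = p

  image-mono : ∀ {A S} → A ⊑ S → image A ⊑ image S
  image-mono {A} {S} A⊑S = mk⊑ vs⊑ es⊑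
    where
      vs⊑ : ∀ y → y ∈ᵥ image A → y ∈ᵥ image S
      vs⊑ y p with from y
      ... | just x = ⊑-vs A⊑S x p
      es⊑ : ∀ y z → Edge (image A) y z → Edge (image S) y z
      es⊑ y z e with from y | from z
      ... | just x | just x′ = ⊑-es A⊑S x x′ e

  image-∖ : ∀ {A B} → image (B ∖ A) ≐ image B ∖ image A
  image-∖ {A} {B} = mk⊑ (λ y → subst T (vs≡ y)) (λ y z → subst T (es≡ y z))
                  , mk⊑ (λ y → subst T (sym (vs≡ y))) (λ y z → subst T (sym (es≡ y z)))
    where
      vs≡ : ∀ y → vs (image (B ∖ A)) y ≡ vs (image B ∖ image A) y
      vs≡ y with from y
      ... | just _  = refl
      ... | nothing = refl
      es≡ : ∀ y z → es (image (B ∖ A)) y z ≡ es (image B ∖ image A) y z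
      es≡ y z with from y | from z
      ... | just _  | just _  = refl
      ... | just _  | nothing = refl
      ... | nothing | _       = refl

  Cover-image : ∀ {S A B} → Cover S A B → Cover (image S) (image A) (image B)
  Cover-image {S} {A} {B} (cover A⊑S B⊑S cv ce ed) =
    cover (image-mono A⊑S) (image-mono B⊑S) vs-cover es-cover es-disjoint
    where
      vs-cover : ∀ y → y ∈ᵥ image S → y ∈ᵥ image A ⊎ y ∈ᵥ image B
      vs-cover y p with from y
      ... | just x = cv x p
      es-cover : ∀ y z → Edge (image S) y z → Edge (image A) y z ⊎ Edge (image B) y z
      es-cover y z e with from y | from z
      ... | just x | just x′ = ce x x′ e
      es-disjoint : ∀ y z → Edge (image A) y z → Edge (image B) y z → ⊥
      es-disjoint y z eA eB with from y | from z
      ... | just x | just x′ = ed x x′ eA eB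

  InterSize-image : ∀ {A B c} → InterSize Δ A B c → InterSize Γ (image A) (image B) c
  InterSize-image {A} {B} (none A∩B-empty) = none meet
    where
      meet : ∀ y → y ∈ᵥ image A → y ∈ᵥ image B → ⊥
      meet y p q with from y
      ... | just x = A∩B-empty x p q
  InterSize-image {A} {B} (one z zA zB uniq) = one (to z) (to∈image A zA) (to∈image B zB) at-z
    where
      at-z : ∀ y → y ∈ᵥ image A → y ∈ᵥ image B → y ≡ to z
      at-z y p q with from y in eq
      ... | just x = trans (sym (to-from eq)) (cong to (uniq x p q))

  image-unique : ∀ {S z} → (∀ x → x ∈ᵥ S → x ≡ z) → ∀ y → y ∈ᵥ image S → y ≡ to z
  image-unique uniq y p with from y in eq
  ... | just x = trans (sym (to-from eq)) (cong to (uniq x p))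

  image-⊈ᵥ : ∀ {A B} → B ⊈ᵥ A → image B ⊈ᵥ image A
  image-⊈ᵥ {A} {B} (b , b∈B , b∉A) = to b , to∈image B b∈B , (λ p → b∉A (to∈image⁻ A p))

  Rtd≤-image : ∀ {S k} → Rtd≤ Δ S k → Rtd≤ Γ (image S) k
  Rtd≤-image {S} (null S-empty) = null S′-empty
    where
      S′-empty : ∀ y → y ∉ᵥ image S
      S′-empty y p with from y
      ... | just x = S-empty x p
  Rtd≤-image {S} (single z z∈S uniq 1≤k) =
    single (to z) (to∈image S z∈S) (image-unique {S} uniq) 1≤k
  Rtd≤-image (split A B c j A⊆S B⊆S cv ce ed isz (a , a∈A) fr dA dB le) =
    split′ (Cover-image (cover (⊆⇒⊑ A⊆S) (⊆⇒⊑ B⊆S) cv ce ed)) (InterSize-image isz)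
           (to a , to∈image A a∈A) (image-⊈ᵥ {A} {B} fr)
           (Rtd≤-image dA) (Rtd≤-resp-≐ image-∖ (Rtd≤-image dB)) le

  Rooted-image : ∀ {S v k} → Rooted S v k → Rooted (image S) (to v) k
  Rooted-image {S} (single v∈S uniq 1≤k) = single (to∈image S v∈S) (image-unique {S} uniq) 1≤k
  Rooted-image (split {A = A} {B = B} cv isz fr v∈A dA dB le) =
    split (Cover-image cv) (InterSize-image isz) (image-⊈ᵥ {A} {B} fr) (to∈image A v∈A)
          (Rooted-image dA)
          (Rtd≤-resp-≐ image-∖ (Rtd≤-image dB)) le

-- Monotonicity under subgraphs

module _ {Δ Γ : Graph} (search : Searchable (V Δ))
         (f : V Δ → V Γ) (f-inj : ∀ {x x′} → f x ≡ f x′ → x ≡ x′) where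

  restrict : Sub Δ → Sub Γ → Sub Δ
  vs (restrict S′ A) x = vs S′ x ∧ vs A (f x)
  es (restrict S′ A) x y = es S′ x y ∧ es A (f x) (f y)
  es⊆E (restrict S′ A) x y e = es⊆E S′ x y (∧-elimˡ e)
  es-sym (restrict S′ A) x y rewrite es-sym S′ x y | es-sym A (f x) (f y) = refl
  es-end (restrict S′ A) x y e =
    ∧-intro (es-end S′ x y (∧-elimˡ e)) (es-end A (f x) (f y) (∧-elimʳ {a = es S′ x y} e))

  module _ {S′ : Sub Δ} {S : Sub Γ} (S′⊑S : S′ ⊑⟨ f ⟩ S) where

    Cover-restrict : ∀ {A B} → Cover S A B → Cover S′ (restrict S′ A) (restrict S′ B)
    Cover-restrict {A} {B} (cover _ _ cv ce ed) =
      cover (mk⊑ (λ _ → ∧-elimˡ) (λ _ _ → ∧-elimˡ)) (mk⊑ (λ _ → ∧-elimˡ) (λ _ _ → ∧-elimˡ))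
            vs-cover es-cover
            (λ x y e₁ e₂ → ed (f x) (f y) (∧-elimʳ {a = es S′ x y} e₁) (∧-elimʳ {a = es S′ x y} e₂))
      where
        vs-cover : ∀ x → x ∈ᵥ S′ → x ∈ᵥ restrict S′ A ⊎ x ∈ᵥ restrict S′ B
        vs-cover x p =
          [ (λ q → inj₁ (∧-intro p q)) , (λ q → inj₂ (∧-intro p q)) ]′ (cv (f x) (⊑-vs S′⊑S x p))
        es-cover : ∀ x y → Edge S′ x y → Edge (restrict S′ A) x y ⊎ Edge (restrict S′ B) x y
        es-cover x y e =
          [ (λ q → inj₁ (∧-intro e q)) , (λ q → inj₂ (∧-intro e q)) ]′ (ce (f x) (f y) (⊑-es S′⊑S x y e))

    Overlap≤-restrict : ∀ {A B c} → InterSize Γ A B c → Overlap≤ (restrict S′ A) (restrict S′ B) c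
    Overlap≤-restrict (none A∩B-empty) =
      disjoint (λ x p q → A∩B-empty (f x) (∧-elimʳ {a = vs S′ x} p) (∧-elimʳ {a = vs S′ x} q))
    Overlap≤-restrict {A} {B} (one z _ _ uniq) =
      at-most-one (λ x y px qx py qy → f-inj (trans (at-z x px qx) (sym (at-z y py qy))))
      where
        at-z : ∀ x → x ∈ᵥ restrict S′ A → x ∈ᵥ restrict S′ B → f x ≡ z
        at-z x p q = uniq (f x) (∧-elimʳ {a = vs S′ x} p) (∧-elimʳ {a = vs S′ x} q)

  restrict-⊑ : ∀ S′ (A : Sub Γ) → restrict S′ A ⊑⟨ f ⟩ A
  restrict-⊑ S′ A = mk⊑ (λ x → ∧-elimʳ {a = vs S′ x}) (λ x y → ∧-elimʳ {a = es S′ x y})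

  restrict-∖-⊑ : ∀ S′ (A B : Sub Γ) → restrict S′ B ∖ restrict S′ A ⊑⟨ f ⟩ B ∖ A
  restrict-∖-⊑ S′ A B = mk⊑ vs⊑ es⊑
    where
      ∉A : ∀ {x} → x ∈ᵥ S′ → T (not (vs (restrict S′ A) x)) → T (not (vs A (f x)))
      ∉A x∈S′ p = not-intro (λ q → not-elim p (∧-intro x∈S′ q))
      vs⊑ : ∀ x → x ∈ᵥ restrict S′ B ∖ restrict S′ A → f x ∈ᵥ B ∖ A
      vs⊑ x p = ∧-intro (∧-elimʳ {a = vs S′ x} (∧-elimˡ p)) (∉A (∧-elimˡ (∧-elimˡ p)) (∧-elimʳ p))
      es⊑ : ∀ x y → Edge (restrict S′ B ∖ restrict S′ A) x y → Edge (B ∖ A) (f x) (f y)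
      es⊑ x y e = ∧-intro (∧-elimʳ {a = es S′ x y} e′)
                          (∧-intro (∉A (es-end S′ x y (∧-elimˡ e′)) (∧-elimˡ ends))
                                   (∉A (Edge-endʳ S′ x y (∧-elimˡ e′)) (∧-elimʳ ends)))
        where
          e′ : Edge (restrict S′ B) x y
          e′ = ∧-elimˡ e
          ends : T (not (vs (restrict S′ A) x) ∧ not (vs (restrict S′ A) y))
          ends = ∧-elimʳ {a = es (restrict S′ B) x y} e

  Rtd≤-pullback : ∀ {S′ S k} → S′ ⊑⟨ f ⟩ S → Rtd≤ Γ S k → Rtd≤ Δ S′ k
  Rtd≤-pullback S′⊑S (null S-empty) = null (λ x p → S-empty (f x) (⊑-vs S′⊑S x p))
  Rtd≤-pullback {S′} S′⊑S (single z _ uniq 1≤k) with search (vs S′)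
  ... | no S′-empty = null (λ x p → S′-empty (x , p))
  ... | yes (x , x∈S′) =
    single x x∈S′ (λ y y∈S′ → f-inj (trans (at-z y y∈S′) (sym (at-z x x∈S′)))) 1≤k
    where
      at-z : ∀ y → y ∈ᵥ S′ → f y ≡ z
      at-z y y∈S′ = uniq (f y) (⊑-vs S′⊑S y y∈S′)
  Rtd≤-pullback {S′} S′⊑S (split A B c j A⊆S B⊆S cv ce ed isz _ _ dA dB le) =
    Rtd≤-split search (Cover-restrict S′⊑S (cover (⊆⇒⊑ A⊆S) (⊆⇒⊑ B⊆S) cv ce ed))
               (Overlap≤-restrict S′⊑S isz)
               (Rtd≤-pullback (restrict-⊑ S′ A) dA) (Rtd≤-pullback (restrict-∖-⊑ S′ A B) dB) le

Rtd≤-⊑ : ∀ {Γ} {S′ S : Sub Γ} {k} → Searchable (V Γ) → S′ ⊑ S → Rtd≤ Γ S k → Rtd≤ Γ S′ k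
Rtd≤-⊑ search = Rtd≤-pullback search id id

-- Deleting a dominating vertex

pred-+ : ∀ {j c k} → 1 ≤ j → j + c ≤ k → pred j + c ≤ pred k
pred-+ {suc _} _ = pred-mono-≤

+-pred : ∀ {j c k} → 1 ≤ c → j + c ≤ k → j + pred c ≤ pred k
+-pred {j} {suc c} {k} _ le = pred-mono-≤ (subst (_≤ k) (+-suc j c) le)

module _ {Γ : Graph} where

  ⟦_⟧ : V Γ → Sub Γ
  vs ⟦ a ⟧ x = ⌊ _≟_ Γ x a ⌋
  es ⟦ a ⟧ _ _ = false
  es⊆E ⟦ a ⟧ _ _ ()
  es-sym ⟦ a ⟧ _ _ = refl
  es-end ⟦ a ⟧ _ _ ()

  Dominates : Sub Γ → V Γ → Set
  Dominates S a = ∀ x → x ∈ᵥ S → x ≢ a → Edge S a x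

  Rtd≤-delete-dominating : Searchable (V Γ) → ∀ {S a k} → Dominates S a → a ∈ᵥ S →
                           Rtd≤ Γ S k → Rtd≤ Γ (S ∖ ⟦ a ⟧) (pred k)
  Rtd≤-delete-dominating _ _ a∈S (null S-empty) = ⊥-elim (S-empty _ a∈S)
  Rtd≤-delete-dominating _ {S} {a} _ a∈S (single z _ uniq _) =
    null (λ x p → not-elim (∧-elimʳ {a = vs S x} p)
                           (fromWitness (trans (uniq x (∧-elimˡ p)) (sym (uniq a a∈S)))))
  Rtd≤-delete-dominating search {S} {a} {k} dom a∈S
                         (split A B c j A⊆S B⊆S cv ce ed isz neA (b , b∈B , b∉A) dA dB le)
    with T? (vs A a)
  -- a has a neighbour b ∈ B ∖ A, so a ∈ B and V(A) ∩ V(B) = {a}: split S − a into A − a and B − a.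
  ... | yes a∈A =
    Rtd≤-split search (Cover-∖ {X = ⟦ a ⟧} cover′) (disjoint only-a)
               (Rtd≤-delete-dominating search dom-A a∈A dA)
               (Rtd≤-⊑ search (⊑-trans (∖-∖-⊑ {B = B} {X = ⟦ a ⟧} {A = A}) ∖-⊑) dB)
               (≤-trans (+-monoʳ-≤ j z≤n) (+-pred 1≤c le))
    where
      cover′ : Cover S A B
      cover′ = cover (⊆⇒⊑ A⊆S) (⊆⇒⊑ B⊆S) cv ce ed
      o : Overlap≤ A B c
      o = InterSize⇒Overlap≤ isz
      a∈B : a ∈ᵥ B
      a∈B with ce a b (dom b (proj₁ B⊆S b b∈B) (λ b≡a → b∉A (subst (_∈ᵥ A) (sym b≡a) a∈A)))
      ... | inj₁ eA = ⊥-elim (b∉A (Edge-endʳ A a b eA))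
      ... | inj₂ eB = es-end B a b eB
      1≤c : 1 ≤ c
      1≤c = Overlap≤-meet⇒1≤ o a∈A a∈B
      at-a : ∀ x → x ∈ᵥ A → x ∈ᵥ B → x ≡ a
      at-a x xA xB = Overlap≤-unique o xA xB a∈A a∈B
      only-a : ∀ x → x ∈ᵥ A ∖ ⟦ a ⟧ → x ∈ᵥ B ∖ ⟦ a ⟧ → ⊥
      only-a x p q = not-elim (∧-elimʳ {a = vs A x} p) (fromWitness (at-a x (∧-elimˡ p) (∧-elimˡ q)))
      dom-A : Dominates A a
      dom-A x xA x≢a with ce a x (dom x (proj₁ A⊆S x xA) x≢a)
      ... | inj₁ eA = eA
      ... | inj₂ eB = ⊥-elim (x≢a (at-a x xA (Edge-endʳ B a x eB)))
  -- The edges from a to A lie in B, so A is the single vertex shared with B, and a dominates B ∖ A.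
  ... | no a∉A =
    Rtd≤-split search (Cover-∖ {X = ⟦ a ⟧} cover′) (Overlap≤-∖ {X = ⟦ a ⟧} o)
               (single w (∧-intro w∈A (fromWitnessFalse w≢a)) (λ x x∈A∖a → only-w x (∧-elimˡ x∈A∖a))
                       1≤pred-k)
               (Rtd≤-⊑ search (∖-∖-⊑ {B = B} {X = ⟦ a ⟧} {A = A})
                       (Rtd≤-delete-dominating search dom-B∖A a∈B∖A dB))
               (pred-+ 1≤j le)
    where
      cover′ : Cover S A B
      cover′ = cover (⊆⇒⊑ A⊆S) (⊆⇒⊑ B⊆S) cv ce ed
      o : Overlap≤ A B c
      o = InterSize⇒Overlap≤ isz
      ≢a : ∀ {x} → x ∈ᵥ A → x ≢ a
      ≢a xA refl = a∉A xA
      A⊆B : ∀ x → x ∈ᵥ A → x ∈ᵥ B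
      A⊆B x xA with ce a x (dom x (proj₁ A⊆S x xA) (≢a xA))
      ... | inj₁ eA = ⊥-elim (a∉A (es-end A a x eA))
      ... | inj₂ eB = Edge-endʳ B a x eB
      w : V Γ
      w = proj₁ neA
      w∈A : w ∈ᵥ A
      w∈A = proj₂ neA
      w≢a : w ≢ a
      w≢a = ≢a w∈A
      only-w : ∀ x → x ∈ᵥ A → x ≡ w
      only-w x xA = Overlap≤-unique o xA (A⊆B x xA) w∈A (A⊆B w w∈A)
      a∈B∖A : a ∈ᵥ B ∖ A
      a∈B∖A = ∧-intro ([ (λ aA → ⊥-elim (a∉A aA)) , id ]′ (cv a a∈S)) (not-intro a∉A)
      dom-B∖A : Dominates (B ∖ A) a
      dom-B∖A x p x≢a with ce a x (dom x (proj₁ B⊆S x (∧-elimˡ p)) x≢a)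
      ... | inj₁ eA = ⊥-elim (a∉A (es-end A a x eA))
      ... | inj₂ eB = ∧-intro eB (∧-intro (not-intro a∉A) (∧-elimʳ {a = vs B x} p))
      1≤j : 1 ≤ j
      1≤j = Rtd≤-nonempty⇒1≤ dB (a , a∈B∖A)
      1≤c : 1 ≤ c
      1≤c = Overlap≤-meet⇒1≤ o w∈A (A⊆B w w∈A)
      1≤pred-k : 1 ≤ pred k
      1≤pred-k = ≤-trans 1≤c (≤-trans (m≤n+m c (pred j)) (pred-+ 1≤j le))

Enumeration : Set → Set
Enumeration A = Σ (List A) (λ xs → ∀ x → x ∈ xs)

Enumeration⇒Searchable : ∀ {A} → Enumeration A → Searchable A
Enumeration⇒Searchable (xs , complete) b with any? (λ x → T? (b x)) xs
... | yes found = yes (satisfied found)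
... | no absent = no (λ (x , bx) → absent (lose (complete x) bx))

IsFinite⇒Enumeration : ∀ {G} → IsFinite G → Enumeration (V G)
IsFinite⇒Enumeration (n , V↔Fin) =
  map from (allFin n) ,
  λ x → subst (_∈ map from (allFin n)) (strictlyInverseʳ x) (∈-map⁺ from (∈-allFin (to x)))
  where open Inverse V↔Fin

Enumeration-⊤⊎ : ∀ {A} → Enumeration A → Enumeration (⊤ ⊎ A)
Enumeration-⊤⊎ (xs , complete) =
  inj₁ tt ∷ map inj₂ xs , λ { (inj₁ tt) → here refl ; (inj₂ x) → there (∈-map⁺ inj₂ (complete x)) }

Searchable-⊤⊎ : ∀ {A} → Searchable A → Searchable (⊤ ⊎ A)
Searchable-⊤⊎ search b with T? (b (inj₁ tt)) | search (λ x → b (inj₂ x))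
... | yes b-tt | _             = yes (inj₁ tt , b-tt)
... | no _     | yes (x , b-x) = yes (inj₂ x , b-x)
... | no ¬b-tt | no ¬b-inj₂    =
  no λ { (inj₁ tt , b-tt) → ¬b-tt b-tt ; (inj₂ x , b-x) → ¬b-inj₂ (x , b-x) }

-- The graphs L_d(B, H, r)

module _ {d : ℕ} {B H : Graph} {r : V H} where

  private
    Λ : Graph
    Λ = L d B H r

    Index : Set
    Index = Fin d × V B

    _≟ᵢ_ : DecidableEquality Index
    _≟ᵢ_ = ×-≡-dec FinP._≟_ (_≟_ B)

  base-embedding : Embedding B Λ
  base-embedding = record
    { to = inj₁ ; from = from ; from-to = λ _ → refl ; to-from = to-from ; E-to = λ _ _ → refl }
    where
      from : V Λ → Maybe (V B)
      from (inj₁ x) = just x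
      from (inj₂ _) = nothing
      to-from : ∀ {v x} → from v ≡ just x → inj₁ x ≡ v
      to-from {inj₁ _} refl = refl

  copy : Index → V H → V Λ
  copy (i , x) y with T? (not ⌊ _≟_ H y r ⌋)
  ... | yes y≢r = inj₂ (i , x , y , y≢r)
  ... | no _    = inj₁ x

  ≡root : ∀ {y} → ¬ T (not ⌊ _≟_ H y r ⌋) → y ≡ r
  ≡root {y} ¬y≢r = decidable-stable (_≟_ H y r) (λ y≢r → ¬y≢r (fromWitnessFalse y≢r))

  uncopy : Index → V Λ → Maybe (V H)
  uncopy (i , x) (inj₁ x′) with _≟_ B x′ x
  ... | yes _ = just r
  ... | no _  = nothing
  uncopy (i , x) (inj₂ (i′ , x′ , y , _)) with (i′ , x′) ≟ᵢ (i , x)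
  ... | yes _ = just y
  ... | no _  = nothing

  copy-root : ∀ ix → copy ix r ≡ inj₁ (proj₂ ix)
  copy-root (i , x) with T? (not ⌊ _≟_ H r r ⌋)
  ... | yes r≢r = ⊥-elim (toWitnessFalse r≢r refl)
  ... | no _    = refl

  copy-nonroot : ∀ ix {y} (y≢r : T (not ⌊ _≟_ H y r ⌋)) →
                 copy ix y ≡ inj₂ (proj₁ ix , proj₂ ix , y , y≢r)
  copy-nonroot (i , x) {y} y≢r with T? (not ⌊ _≟_ H y r ⌋)
  ... | yes y≢r′ = cong (λ p → inj₂ (i , x , y , p)) (T-irrelevant y≢r′ y≢r)
  ... | no ¬y≢r  = ⊥-elim (¬y≢r y≢r)

  uncopy-root : ∀ ix → uncopy ix (inj₁ (proj₂ ix)) ≡ just r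
  uncopy-root (i , x) with _≟_ B x x
  ... | yes _   = refl
  ... | no x≢x = ⊥-elim (x≢x refl)

  uncopy-own : ∀ i x q → uncopy (i , x) (inj₂ (i , x , q)) ≡ just (proj₁ q)
  uncopy-own i x q with (i , x) ≟ᵢ (i , x)
  ... | yes _   = refl
  ... | no ix≢ix = ⊥-elim (ix≢ix refl)

  uncopy-inj₁ : ∀ ix x′ {y} → uncopy ix (inj₁ x′) ≡ just y → x′ ≡ proj₂ ix
  uncopy-inj₁ (i , x) x′ eq with _≟_ B x′ x
  ... | yes x′≡x = x′≡x

  uncopy-inj₂ : ∀ ix i′ x′ q {y} → uncopy ix (inj₂ (i′ , x′ , q)) ≡ just y → (i′ , x′) ≡ ix
  uncopy-inj₂ (i , x) i′ x′ q eq with (i′ , x′) ≟ᵢ (i , x)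
  ... | yes eq′ = eq′

  copy-embedding : Index → Embedding H Λ
  copy-embedding ix@(i , x) = record
    { to = copy ix ; from = uncopy ix ; from-to = from-to ; to-from = to-from ; E-to = E-to }
    where
      from-to : ∀ y → uncopy ix (copy ix y) ≡ just y
      from-to y with T? (not ⌊ _≟_ H y r ⌋)
      ... | yes y≢r  = uncopy-own i x (y , y≢r)
      ... | no ¬y≢r with refl ← ≡root ¬y≢r = uncopy-root ix

      to-from : ∀ {v y} → uncopy ix v ≡ just y → copy ix y ≡ v
      to-from {inj₁ x′} eq with _≟_ B x′ x
      to-from {inj₁ x′} refl | yes refl = copy-root ix
      to-from {inj₁ x′} ()   | no _
      to-from {inj₂ (i′ , x′ , y′ , y′≢r)} eq with (i′ , x′) ≟ᵢ (i , x)
      to-from {inj₂ (i′ , x′ , y′ , y′≢r)} () | no _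
      to-from {inj₂ (i  , x  , y′ , y′≢r)} refl | yes refl = copy-nonroot ix y′≢r

      E-to : ∀ y y′ → E Λ (copy ix y) (copy ix y′) ≡ E H y y′
      E-to y y′ with T? (not ⌊ _≟_ H y r ⌋) | T? (not ⌊ _≟_ H y′ r ⌋)
      ... | yes _ | yes _ rewrite ≟-refl FinP._≟_ i | ≟-refl (_≟_ B) x = refl
      ... | yes _ | no ¬y′≢r with refl ← ≡root ¬y′≢r rewrite ≟-refl (_≟_ B) x = E-sym H r y
      ... | no ¬y≢r | yes _ with refl ← ≡root ¬y≢r rewrite ≟-refl (_≟_ B) x = refl
      ... | no ¬y≢r | no ¬y′≢r with refl ← ≡root ¬y≢r | refl ← ≡root ¬y′≢r =
        trans (E-irr B x) (sym (E-irr H r))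

  Base : Sub Λ
  Base = image base-embedding (full B)

  Copy : Index → Sub Λ
  Copy ix = image (copy-embedding ix) (full H)

  uncopy-defined : ∀ ix v → v ∈ᵥ Copy ix → ∃ λ y → uncopy ix v ≡ just y
  uncopy-defined ix v = image-from (copy-embedding ix) (full H) {v}

  Copy-meets-Base : ∀ ix v → v ∈ᵥ Copy ix → v ∈ᵥ Base → v ≡ inj₁ (proj₂ ix)
  Copy-meets-Base ix v@(inj₁ x′) p _ = cong inj₁ (uncopy-inj₁ ix x′ (proj₂ (uncopy-defined ix v p)))

  Copies-meet-in-Base : ∀ ix ix′ v → ix ≢ ix′ → v ∈ᵥ Copy ix → v ∈ᵥ Copy ix′ → v ∈ᵥ Base
  Copies-meet-in-Base _ _ (inj₁ _) _ _ _ = tt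
  Copies-meet-in-Base ix ix′ v@(inj₂ (i , x , q)) ix≢ix′ p p′ =
    ⊥-elim (ix≢ix′ (trans (sym (uncopy-inj₂ ix i x q (proj₂ (uncopy-defined ix v p))))
                          (uncopy-inj₂ ix′ i x q (proj₂ (uncopy-defined ix′ v p′)))))

  module _ (enum : Enumeration (V B)) where

    private
      indices : List Index
      indices = cartesianProduct (allFin d) (proj₁ enum)

      Copy⊑⋃ : ∀ ix → Copy ix ⊑ ⋃ Copy indices
      Copy⊑⋃ (i , x) = ⊑-⋃ (∈-cartesianProduct⁺ (∈-allFin i) (proj₂ enum x))

      in-Copy : ∀ ix u w {y y′} → uncopy ix u ≡ just y → uncopy ix w ≡ just y′ → T (E Λ u w) →
                Edge (Base ∪ ⋃ Copy indices) u w
      in-Copy ix u w eq eq′ e =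
        ∨-introʳ (⊑-es (Copy⊑⋃ ix) _ _ (image-full-edge (copy-embedding ix) u w eq eq′ e))

    full-L-covered : full Λ ⊑ Base ∪ ⋃ Copy indices
    full-L-covered = mk⊑ vs⊑ es⊑
      where
        vs⊑ : ∀ v → v ∈ᵥ full Λ → v ∈ᵥ Base ∪ ⋃ Copy indices
        vs⊑ (inj₁ _) _ = tt
        vs⊑ (inj₂ (i , x , q)) _ =
          ⊑-vs (Copy⊑⋃ (i , x)) _
               (from∈image (copy-embedding (i , x)) (full H) (inj₂ (i , x , q)) (uncopy-own i x q) tt)
        es⊑ : ∀ u w → Edge (full Λ) u w → Edge (Base ∪ ⋃ Copy indices) u w
        es⊑ (inj₁ _) (inj₁ _) e = ∨-introˡ e
        es⊑ (inj₁ x′) (inj₂ (i , x , q)) e with refl ← toWitness {a? = _≟_ B x′ x} (∧-elimˡ e) =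
          in-Copy (i , x) (inj₁ x) (inj₂ (i , x , q)) (uncopy-root (i , x)) (uncopy-own i x q) e
        es⊑ (inj₂ (i , x , q)) (inj₁ x′) e with refl ← toWitness {a? = _≟_ B x′ x} (∧-elimˡ e) =
          in-Copy (i , x) (inj₂ (i , x , q)) (inj₁ x) (uncopy-own i x q) (uncopy-root (i , x)) e
        es⊑ (inj₂ (i , x , q)) (inj₂ (i′ , x′ , q′)) e
          with refl ← toWitness {a? = FinP._≟_ i i′} (∧-elimˡ e)
             | refl ← toWitness {a? = _≟_ B x x′} (∧-elimˡ (∧-elimʳ {a = ⌊ FinP._≟_ i i′ ⌋} e)) =
          in-Copy (i , x) (inj₂ (i , x , q)) (inj₂ (i , x , q′)) (uncopy-own i x q) (uncopy-own i x q′) e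

    Rooted-L : ∀ {v k} → Rooted (full B) v k → Rooted (full H) r k → Rooted (full Λ) (inj₁ v) k
    Rooted-L {k = k} dB dH =
      Rooted-resp-≐ (⊑-full , full-L-covered)
        (Rooted-glue-all _≟ᵢ_ (Rooted-image base-embedding dB) (λ _ → tt) dCopy
                         Copy-meets-Base Copies-meet-in-Base indices)
      where
        dCopy : ∀ ix → Rooted (Copy ix) (inj₁ (proj₂ ix)) k
        dCopy ix =
          subst (λ v → Rooted (Copy ix) v k) (copy-root ix) (Rooted-image (copy-embedding ix) dH)

Rtd≤-L⇒Rtd≤-base : ∀ {d B H r k} → Searchable (V B) →
                    Rtd≤ (L d B H r) (full _) k → Rtd≤ B (full B) k
Rtd≤-L⇒Rtd≤-base search = Rtd≤-pullback search inj₁ inj₁-injective (mk⊑ (λ _ _ → tt) (λ _ _ e → e))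

module _ {G : Graph} where

  private
    apex : V (K₁ ⊕ G)
    apex = inj₁ tt

  inj₂-embedding : Embedding G (K₁ ⊕ G)
  inj₂-embedding = record
    { to = inj₂ ; from = from ; from-to = λ _ → refl ; to-from = to-from ; E-to = λ _ _ → refl }
    where
      from : V (K₁ ⊕ G) → Maybe (V G)
      from (inj₁ _) = nothing
      from (inj₂ y) = just y
      to-from : ∀ {v y} → from v ≡ just y → inj₂ y ≡ v
      to-from {inj₂ _} refl = refl

  image-G≐K₁⊕G∖apex : image inj₂-embedding (full G) ≐ full (K₁ ⊕ G) ∖ ⟦ apex ⟧
  image-G≐K₁⊕G∖apex =
      mk⊑ (λ { (inj₁ _) () ; (inj₂ _) _ → tt })
          (λ { (inj₂ _) (inj₂ _) e → ∧-intro e tt ; (inj₁ _) _ () ; (inj₂ _) (inj₁ _) () })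
    , mk⊑ (λ { (inj₁ _) () ; (inj₂ _) _ → tt })
          (λ { (inj₂ _) (inj₂ _) e → ∧-elimˡ e ; (inj₁ _) (inj₁ _) () ; (inj₁ _) (inj₂ _) ()
             ; (inj₂ _) (inj₁ _) () })

  Rooted-K₁⊕ : Searchable (V G) → ∀ {t} → Rtd≤ G (full G) t → Rooted (full (K₁ ⊕ G)) apex (suc t)
  Rooted-K₁⊕ search dG with search (λ _ → true)
  ... | no G-empty = single tt only-apex (s≤s z≤n)
    where
      only-apex : ∀ x → x ∈ᵥ full (K₁ ⊕ G) → x ≡ apex
      only-apex (inj₁ tt) _ = refl
      only-apex (inj₂ y)  _ = ⊥-elim (G-empty (y , tt))
  ... | yes (y , _) =
    split {A = ⟦ apex ⟧} {B = full (K₁ ⊕ G)}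
          (cover ⊑-full ⊑-refl (λ _ _ → inj₂ tt) (λ _ _ e → inj₂ e) (λ _ _ ()))
          (one apex tt tt (λ x x∈A _ → toWitness x∈A)) (inj₂ y , tt , (λ ()))
          tt (single tt (λ x x∈A → toWitness x∈A) (s≤s z≤n))
          (Rtd≤-resp-≐ image-G≐K₁⊕G∖apex (Rtd≤-image inj₂-embedding dG))
          (≤-reflexive (+-comm _ 1))

  apex-dominates : Dominates (full (K₁ ⊕ G)) apex
  apex-dominates (inj₁ tt) _ apex≢apex = ⊥-elim (apex≢apex refl)
  apex-dominates (inj₂ _)  _ _         = tt

  Rtd≤-K₁⊕⇒Rtd≤-pred : Searchable (V G) → ∀ {k} →
                        Rtd≤ (K₁ ⊕ G) (full _) k → Rtd≤ G (full G) (pred k)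
  Rtd≤-K₁⊕⇒Rtd≤-pred search D =
    Rtd≤-pullback search inj₂ inj₂-injective (mk⊑ (λ _ _ → tt) (λ _ _ e → ∧-intro e tt))
      (Rtd≤-delete-dominating (Searchable-⊤⊎ search) apex-dominates tt D)

open RGraph

lemma29 : (G : Graph) → IsFinite G → (h d : ℕ) → 1 ≤ h → 1 ≤ d →
          (k : ℕ) → Rtd G k → Rtd (RGraph.graph (Thd h d G)) (suc k)
lemma29 G finite (suc h) d _ _ k (G≤k , k-least) = Rooted⇒Rtd≤ (rooted h) , least
  where
    enum : Enumeration (V G)
    enum = IsFinite⇒Enumeration {G} finite

    search : Searchable (V G)
    search = Enumeration⇒Searchable enum

    rooted : ∀ h → Rooted (full (graph (Thd (suc h) d G))) (root (Thd (suc h) d G)) (suc k)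
    rooted zero    = Rooted-K₁⊕ search G≤k
    rooted (suc h) = Rooted-L (Enumeration-⊤⊎ enum) (Rooted-K₁⊕ search G≤k) (rooted h)

    to-K₁⊕G : ∀ h {j} → Rtd≤ (graph (Thd (suc h) d G)) (full _) j → Rtd≤ (K₁ ⊕ G) (full _) j
    to-K₁⊕G zero    D = D
    to-K₁⊕G (suc h) D = Rtd≤-L⇒Rtd≤-base (Searchable-⊤⊎ search) D

    least : ∀ j → Rtd≤ (graph (Thd (suc h) d G)) (full _) j → suc k ≤ j
    least j D = m≤pred[n]⇒suc[m]≤n {{>-nonZero 1≤j}} (k-least (pred j) (Rtd≤-K₁⊕⇒Rtd≤-pred search D′))
      where
        D′ : Rtd≤ (K₁ ⊕ G) (full _) j
        D′ = to-K₁⊕G h D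
        1≤j : 1 ≤ j
        1≤j = Rtd≤-nonempty⇒1≤ D′ (inj₁ tt , tt)
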